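{- For all positive integers $n,s,j$, $$\sum_{b=1}^{n^s}(b,n^s)_s\,e^{\frac{2\pi i b j}{n^s}}=\sum_{d^s\mid (j,n^s)_s} d^s\,\Phi_s\!\left(\frac{n^s}{d^s}\right),$$ where the sum on the right runs over the positive integers $d$ such that $d^s$ divides $(j,n^s)_s$.
   Context: For a positive integer $s$ and integers $a,b$ not both zero, $(a,b)_s$ denotes the largest $l^s$ with $l\in\mathbb{N}$ dividing both $a$ and $b$. For positive integers $s,m$, Klee's function $\Phi_s(m)$ is the number of integers $k$ with $1\le k\le m$ and $(k,m)_s=1$. -}

module Defs where

open import Level using (Level)
open import Data.Nat using (ℕ; zero; suc; _+_; _*_; _^_; _<_; _⊔_; _/_; NonZero)
open import Data.Nat.Divisibility using (_∣_; _∣?_)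
open import Data.Bool using (Bool; true; false; if_then_else_; _∧_)
open import Relation.Nullary.Decidable using (⌊_⌋)
open import Relation.Nullary using (¬_)
open import Relation.Binary.PropositionalEquality using (_≡_)
open import Data.Product using (_×_)
open import Data.Sum using (_⊎_)
open import Algebra.Bundles using (CommutativeRing)

-- (a , b)_s : the largest l^s (l ∈ ℕ, l ≥ 1) dividing both a and b.
-- Candidates l range over 1 .. a + b (any such l satisfies l ≤ l^s ≤ max a b
-- when s ≥ 1 and a, b not both zero).

private
  best : ℕ → ℕ → ℕ → ℕ → ℕ
  best s a b zero    = 0
  best s a b (suc l) =
    if ⌊ suc l ^ s ∣? a ⌋ ∧ ⌊ suc l ^ s ∣? b ⌋
    then (suc l ^ s) ⊔ best s a b l
    else best s a b l

gcdPow : ℕ → ℕ → ℕ → ℕ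
gcdPow s a b = best s a b (a + b)

countUpTo : ℕ → (ℕ → Bool) → ℕ
countUpTo zero    p = 0
countUpTo (suc m) p = (if p (suc m) then 1 else 0) + countUpTo m p

open import Data.Nat using (_≡ᵇ_)
Klee : ℕ → ℕ → ℕ
Klee s m = countUpTo m (λ k → gcdPow s k m ≡ᵇ 1)

-- Σ over d with 1 ≤ d ≤ g and d^s ∣ g of d^s · Φ_s(N / d^s)   (ℕ-valued)
-- (every positive d with d^s ∣ g, g ≥ 1, satisfies d ≤ d^s ≤ g when s ≥ 1)
open import Data.Nat.Properties using (m^n≢0)
open import Data.Nat.DivMod using (_/_)

kleeSum : (s N g d : ℕ) → ℕ
kleeSum s N g zero    = 0
kleeSum s N g (suc d) =
  (if ⌊ suc d ^ s ∣? g ⌋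
   then (suc d ^ s) * (Klee s (_/_ N (suc d ^ s) {{m^n≢0 (suc d) s}}))
   else 0)
  + kleeSum s N g d

-- Ring-side helpers (the complex numbers are replaced by an arbitrary
-- integral domain of characteristic zero containing a primitive root of
-- unity)

module _ {c ℓ : Level} (R : CommutativeRing c ℓ) where
  open CommutativeRing R renaming (_+_ to _+R_; _*_ to _*R_)

  fromℕ : ℕ → Carrier
  fromℕ zero    = 0#
  fromℕ (suc n) = 1# +R fromℕ n

  pow : Carrier → ℕ → Carrier
  pow x zero    = 1#
  pow x (suc n) = x *R pow x n

  sumR : ℕ → (ℕ → Carrier) → Carrier
  sumR zero    f = 0#
  sumR (suc m) f = f (suc m) +R sumR m f

  IsIntegralDomain : Set (c Level.⊔ ℓ)
  IsIntegralDomain = ∀ x y → x *R y ≈ 0# → (x ≈ 0#) ⊎ (y ≈ 0#)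

  CharZero : Set ℓ
  CharZero = ∀ n → fromℕ n ≈ 0# → n ≡ 0

  IsPrimitiveRoot : ℕ → Carrier → Set ℓ
  IsPrimitiveRoot m ζ = (pow ζ m ≈ 1#) × (∀ k → 0 < k → k < m → ¬ (pow ζ k ≈ 1#))

{-# OPTIONS --safe #-}

-- Write (b, n^s)_s = L^s, where L is the largest divisor of n with L^s ∣ b.  Sorting the
-- k ≤ L^s by the value (k, L^s)_s = c^s (c ∣ L) and scaling k = k′ c^s, there are exactly
-- Φ_s((L/c)^s) of each kind, so L^s = Σ_{d ∣ L} Φ_s(d^s) and (b, n^s)_s = Σ_{d ∣ n, d^s ∣ b} Φ_s(d^s).
-- Substituting this and exchanging the sums, for each d ∣ n the inner sum over the multiples
-- b of d^s is a complete sum of powers of ζ^(d^s), a primitive (n/d)^s-th root of unity; it is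
-- (n/d)^s when (n/d)^s ∣ j and 0 otherwise.  Replacing d by n/d gives the right-hand side,
-- because e^s ∣ (j, n^s)_s exactly when e ∣ n and e^s ∣ j.

module Submission where

open import Level using (Level)
open import Algebra.Bundles using (CommutativeSemiring; CommutativeRing)
open import Data.Bool using (if_then_else_)
open import Data.Empty using (⊥-elim)
open import Data.Product using (_×_; _,_; proj₁; proj₂; ∃-syntax)
open import Data.Sum using (_⊎_; inj₁; inj₂)
open import Function using (_∘_; flip)
open import Function.Bundles using (_⇔_; mk⇔; Equivalence)
open import Relation.Nullary using (¬_; Dec; yes; no)
open import Relation.Nullary.Decidable using (⌊_⌋; isYes≗does)
import Relation.Binary.PropositionalEquality as ≡
open ≡ using (_≡_)

open import Defs

module _ {a p} {A : Set a} {P : Set p} {x y : A} where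

  if-yes : (P? : Dec P) → P → (if ⌊ P? ⌋ then x else y) ≡ x
  if-yes (yes _) _ = ≡.refl
  if-yes (no ¬p) p = ⊥-elim (¬p p)

  if-no : (P? : Dec P) → ¬ P → (if ⌊ P? ⌋ then x else y) ≡ y
  if-no (yes p) ¬p = ⊥-elim (¬p p)
  if-no (no _)  _  = ≡.refl

if-cong : ∀ {a p q} {A : Set a} {P : Set p} {Q : Set q} (P? : Dec P) (Q? : Dec Q) {x y z : A} →
          P ⇔ Q → (P → x ≡ y) → (if ⌊ P? ⌋ then x else z) ≡ (if ⌊ Q? ⌋ then y else z)
if-cong (yes p) (yes _) _   x≡y = x≡y p
if-cong (yes p) (no ¬q) P⇔Q _   = ⊥-elim (¬q (Equivalence.to P⇔Q p))
if-cong (no ¬p) (yes q) P⇔Q _   = ⊥-elim (¬p (Equivalence.from P⇔Q q))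
if-cong (no _)  (no _)  _   _   = ≡.refl

module FiniteSum {c ℓ} (S : CommutativeSemiring c ℓ) where

  open import Data.Nat using (ℕ; zero; suc; _≤_; _<_; _≟_; z≤n; s≤s; NonZero; >-nonZero)
    renaming (_+_ to _+ℕ_; _*_ to _*ℕ_)
  open import Data.Nat.Properties using (≤-refl; ≤-pred; m≤n⇒m≤1+n; m≤n⇒m<n∨m≡n; <⇒≢; <⇒≱)
    renaming (+-comm to +ℕ-comm)
  open import Data.Nat.Divisibility using (_∣_; _∣?_; n∣m*n; ∣m+n∣m⇒∣n; ∣⇒≤)
  open CommutativeSemiring S
  open import Relation.Binary.Reasoning.Setoid setoid
  open import Algebra.Properties.CommutativeSemigroup +-commutativeSemigroup using (interchange)

  ∑ : ℕ → (ℕ → Carrier) → Carrier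
  ∑ zero    f = 0#
  ∑ (suc m) f = f (suc m) + ∑ m f

  ∑-cong : ∀ m {f g : ℕ → Carrier} → (∀ i → 1 ≤ i → i ≤ m → f i ≈ g i) → ∑ m f ≈ ∑ m g
  ∑-cong zero    f≈g = refl
  ∑-cong (suc m) f≈g =
    +-cong (f≈g (suc m) (s≤s z≤n) ≤-refl) (∑-cong m (λ i 1≤i i≤m → f≈g i 1≤i (m≤n⇒m≤1+n i≤m)))

  ∑-zero : ∀ m {f : ℕ → Carrier} → (∀ i → 1 ≤ i → i ≤ m → f i ≈ 0#) → ∑ m f ≈ 0#
  ∑-zero m f≈0 = trans (∑-cong m f≈0) (∑0 m)
    where
    ∑0 : ∀ m → ∑ m (λ _ → 0#) ≈ 0#
    ∑0 zero    = refl
    ∑0 (suc m) = trans (+-identityˡ _) (∑0 m)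

  ∑-distrib-+ : ∀ m (f g : ℕ → Carrier) → ∑ m (λ i → f i + g i) ≈ ∑ m f + ∑ m g
  ∑-distrib-+ zero    f g = sym (+-identityˡ 0#)
  ∑-distrib-+ (suc m) f g = trans (+-congˡ (∑-distrib-+ m f g)) (interchange _ _ _ _)

  *-distribˡ-∑ : ∀ m x (f : ℕ → Carrier) → x * ∑ m f ≈ ∑ m (λ i → x * f i)
  *-distribˡ-∑ zero    x f = zeroʳ x
  *-distribˡ-∑ (suc m) x f = trans (distribˡ x _ _) (+-congˡ (*-distribˡ-∑ m x f))

  *-distribʳ-∑ : ∀ m x (f : ℕ → Carrier) → ∑ m f * x ≈ ∑ m (λ i → f i * x)
  *-distribʳ-∑ zero    x f = zeroˡ x
  *-distribʳ-∑ (suc m) x f = trans (distribʳ x _ _) (+-congˡ (*-distribʳ-∑ m x f))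

  ∑-comm : ∀ m n (f : ℕ → ℕ → Carrier) → ∑ m (λ i → ∑ n (f i)) ≈ ∑ n (λ k → ∑ m (λ i → f i k))
  ∑-comm zero    n f = sym (∑-zero n (λ _ _ _ → refl))
  ∑-comm (suc m) n f = trans (+-congˡ (∑-comm m n f)) (sym (∑-distrib-+ n (f (suc m)) _))

  ∑-split : ∀ m k (f : ℕ → Carrier) → ∑ (m +ℕ k) f ≈ ∑ m (λ i → f (i +ℕ k)) + ∑ k f
  ∑-split zero    k f = sym (+-identityˡ _)
  ∑-split (suc m) k f = trans (+-congˡ (∑-split m k f)) (sym (+-assoc _ _ _))

  ∑-truncate : ∀ k m (f : ℕ → Carrier) → k ≤ m → (∀ i → k < i → f i ≈ 0#) → ∑ m f ≈ ∑ k f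
  ∑-truncate k zero    f z≤n  f≈0 = refl
  ∑-truncate k (suc m) f k≤1+m f≈0 with m≤n⇒m<n∨m≡n k≤1+m
  ... | inj₁ k<1+m =
    trans (+-cong (f≈0 (suc m) k<1+m) (∑-truncate k m f (≤-pred k<1+m) f≈0)) (+-identityˡ _)
  ... | inj₂ ≡.refl = refl

  ∑-δ : ∀ m {t} x → 1 ≤ t → t ≤ m → ∑ m (λ i → if ⌊ i ≟ t ⌋ then x else 0#) ≈ x
  ∑-δ zero    x 1≤t t≤0 = ⊥-elim (<⇒≱ 1≤t t≤0)
  ∑-δ (suc m) {t} x 1≤t t≤1+m with m≤n⇒m<n∨m≡n t≤1+m
  ... | inj₁ t<1+m = begin
    δ (suc m) + ∑ m δ  ≡⟨ ≡.cong (_+ ∑ m δ) (if-no (suc m ≟ t) (<⇒≢ t<1+m ∘ ≡.sym)) ⟩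
    0# + ∑ m δ         ≈⟨ +-identityˡ _ ⟩
    ∑ m δ              ≈⟨ ∑-δ m x 1≤t (≤-pred t<1+m) ⟩
    x                  ∎
    where δ = λ i → if ⌊ i ≟ t ⌋ then x else 0#
  ... | inj₂ ≡.refl = begin
    δ t + ∑ m δ  ≡⟨ ≡.cong (_+ ∑ m δ) (if-yes (t ≟ t) ≡.refl) ⟩
    x + ∑ m δ    ≈⟨ +-congˡ (∑-zero m (λ i _ i≤m → reflexive (if-no (i ≟ t) (<⇒≢ (s≤s i≤m))))) ⟩
    x + 0#       ≈⟨ +-identityʳ x ⟩
    x            ∎
    where δ = λ i → if ⌊ i ≟ t ⌋ then x else 0#

  ∑-multiples : ∀ m k (f : ℕ → Carrier) → .{{NonZero k}} →
                ∑ (m *ℕ k) (λ i → if ⌊ k ∣? i ⌋ then f i else 0#) ≈ ∑ m (λ i → f (i *ℕ k))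
  ∑-multiples zero    k       f = refl
  ∑-multiples (suc m) (suc k) f = begin
    ∑ (suc k +ℕ m *ℕ suc k) g
      ≈⟨ ∑-split (suc k) (m *ℕ suc k) g ⟩
    (g (suc m *ℕ suc k) + ∑ k (λ i → g (i +ℕ m *ℕ suc k))) + ∑ (m *ℕ suc k) g
      ≈⟨ +-cong (+-cong (reflexive (if-yes (suc k ∣? _) (n∣m*n (suc m))))
                        (∑-zero k (λ i 1≤i i≤k → reflexive (if-no (suc k ∣? _) (¬∣ i 1≤i i≤k)))))
                (∑-multiples m (suc k) f) ⟩
    (f (suc m *ℕ suc k) + 0#) + ∑ m (λ i → f (i *ℕ suc k))
      ≈⟨ +-congʳ (+-identityʳ _) ⟩
    ∑ (suc m) (λ i → f (i *ℕ suc k))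
      ∎
    where
    g = λ i → if ⌊ suc k ∣? i ⌋ then f i else 0#
    ¬∣ : ∀ i → 1 ≤ i → i ≤ k → ¬ (suc k ∣ i +ℕ m *ℕ suc k)
    ¬∣ i 1≤i i≤k k+1∣ =
      <⇒≱ (s≤s i≤k) (∣⇒≤ {{>-nonZero 1≤i}} (∣m+n∣m⇒∣n (≡.subst (suc k ∣_) (+ℕ-comm i _) k+1∣) (n∣m*n m)))

module Arithmetic where

  open import Data.Nat
  open import Data.Bool using (_∧_)
  open import Data.Bool.Properties using (if-float)
  open import Data.Nat.Properties
  open import Data.Nat.Divisibility
  open import Data.Nat.DivMod using (m/n*n≡m; m*n/n≡m; m*[n/m]≡n; m/n≤m)
  open import Data.Nat.GCD using (gcd; gcd[m,n]∣m; gcd[m,n]∣n; gcd[m,n]≢0; c*gcd[m,n]≡gcd[cm,cn])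
  open import Data.Nat.LCM using (lcm; m∣lcm[m,n]; n∣lcm[m,n]; lcm-least; gcd*lcm)
  open import Data.Nat.Coprimality using (Coprime; coprime-divisor; coprime⇒gcd≡1; gcd≡1⇒coprime; coprime-/gcd)
  import Data.Nat.Coprimality as Coprime
  open import Data.Nat.Solver using (module +-*-Solver)
  open +-*-Solver using (solve; _:=_; _:*_)
  open import Relation.Binary.Definitions using (tri<; tri≈; tri>)
  open ≡ using (refl; sym; trans; cong; cong₂; subst)
  open ≡.≡-Reasoning

  ^-distrib-* : ∀ m n s → (m * n) ^ s ≡ m ^ s * n ^ s
  ^-distrib-* m n zero    = refl
  ^-distrib-* m n (suc s) rewrite ^-distrib-* m n s =
    solve 4 (λ m n p q → (m :* n) :* (p :* q) := (m :* p) :* (n :* q)) refl m n (m ^ s) (n ^ s)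

  0^n≡0 : ∀ n .{{_ : NonZero n}} → 0 ^ n ≡ 0
  0^n≡0 (suc n) = refl

  m≤m^n : ∀ m n .{{_ : NonZero n}} → m ≤ m ^ n
  m≤m^n zero    n       = z≤n
  m≤m^n (suc m) (suc n) = m≤m*n (suc m) (suc m ^ n) {{m^n≢0 (suc m) n}}

  ^-injective : ∀ {m n} s .{{_ : NonZero s}} → m ^ s ≡ n ^ s → m ≡ n
  ^-injective {m} {n} s eq with <-cmp m n
  ... | tri< m<n _ _ = ⊥-elim (<⇒≢ (^-monoˡ-< s m<n) eq)
  ... | tri≈ _ m≡n _ = m≡n
  ... | tri> _ _ n<m = ⊥-elim (<⇒≢ (^-monoˡ-< s n<m) (sym eq))

  ^-monoˡ-∣ : ∀ {m n} s → m ∣ n → m ^ s ∣ n ^ s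
  ^-monoˡ-∣ zero    _   = ∣-refl
  ^-monoˡ-∣ (suc s) m∣n = *-pres-∣ m∣n (^-monoˡ-∣ s m∣n)

  ∣-nonZero : ∀ {m n} → m ∣ n → .{{_ : NonZero n}} → NonZero m
  ∣-nonZero {n = n} m∣n = ≢-nonZero (λ { refl → ≢-nonZero⁻¹ n (0∣⇒≡0 m∣n) })

  ^-nonZero⁻¹ : ∀ {m} n .{{_ : NonZero n}} → NonZero (m ^ n) → NonZero m
  ^-nonZero⁻¹ {suc m} n _      = _
  ^-nonZero⁻¹ {zero}  n 0^n≢0 = ⊥-elim (≢-nonZero⁻¹ (0 ^ n) {{0^n≢0}} (0^n≡0 n))

  gcd≢0ˡ : ∀ m n .{{_ : NonZero m}} → NonZero (gcd m n)
  gcd≢0ˡ m n = ≢-nonZero (gcd[m,n]≢0 m n (inj₁ (≢-nonZero⁻¹ m)))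

  coprime-* : ∀ {m n o} → Coprime m n → Coprime m o → Coprime m (n * o)
  coprime-* {m} {n} m⊥n m⊥o {d} (d∣m , d∣no) = m⊥o (d∣m , coprime-divisor d⊥n d∣no)
    where
    d⊥n : Coprime d n
    d⊥n = gcd≡1⇒coprime (m⊥n (∣-trans (gcd[m,n]∣m d n) d∣m , gcd[m,n]∣n d n))

  coprime-^ : ∀ {m n} s → Coprime m n → Coprime (m ^ s) (n ^ s)
  coprime-^ {m} {n} s m⊥n = Coprime.sym (coprime-^ʳ s (Coprime.sym (coprime-^ʳ s m⊥n)))
    where
    coprime-^ʳ : ∀ {a b} s → Coprime a b → Coprime a (b ^ s)
    coprime-^ʳ zero    _   (_ , d∣1) = ∣1⇒≡1 d∣1
    coprime-^ʳ (suc s) a⊥b = coprime-* a⊥b (coprime-^ʳ s a⊥b)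

  gcd-^ : ∀ m n s .{{_ : NonZero m}} → gcd (m ^ s) (n ^ s) ≡ gcd m n ^ s
  gcd-^ m n s = begin
    gcd (m ^ s) (n ^ s)
      ≡⟨ cong₂ (λ x y → gcd (x ^ s) (y ^ s)) (split m (gcd[m,n]∣m m n)) (split n (gcd[m,n]∣n m n)) ⟩
    gcd ((g * m′) ^ s) ((g * n′) ^ s)
      ≡⟨ cong₂ gcd (^-distrib-* g m′ s) (^-distrib-* g n′ s) ⟩
    gcd (g ^ s * m′ ^ s) (g ^ s * n′ ^ s)
      ≡⟨ sym (c*gcd[m,n]≡gcd[cm,cn] (g ^ s) (m′ ^ s) (n′ ^ s)) ⟩
    g ^ s * gcd (m′ ^ s) (n′ ^ s)
      ≡⟨ cong (g ^ s *_) (coprime⇒gcd≡1 (coprime-^ s (coprime-/gcd m n))) ⟩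
    g ^ s * 1
      ≡⟨ *-identityʳ (g ^ s) ⟩
    g ^ s
      ∎
    where
    g = gcd m n
    instance
      g≢0 : NonZero g
      g≢0 = gcd≢0ˡ m n
    m′ = m / g
    n′ = n / g
    split : ∀ x → g ∣ x → x ≡ g * (x / g)
    split x g∣x = trans (sym (m/n*n≡m g∣x)) (*-comm (x / g) g)

  lcm-^ : ∀ m n s .{{_ : NonZero m}} → lcm (m ^ s) (n ^ s) ≡ lcm m n ^ s
  lcm-^ m n s = *-cancelˡ-≡ (lcm (m ^ s) (n ^ s)) (lcm m n ^ s) (gcd m n ^ s) (begin
    gcd m n ^ s * lcm (m ^ s) (n ^ s)          ≡⟨ cong (_* lcm (m ^ s) (n ^ s)) (sym (gcd-^ m n s)) ⟩
    gcd (m ^ s) (n ^ s) * lcm (m ^ s) (n ^ s)  ≡⟨ gcd*lcm (m ^ s) (n ^ s) ⟩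
    m ^ s * n ^ s                              ≡⟨ sym (^-distrib-* m n s) ⟩
    (m * n) ^ s                                ≡⟨ cong (_^ s) (sym (gcd*lcm m n)) ⟩
    (gcd m n * lcm m n) ^ s                    ≡⟨ ^-distrib-* (gcd m n) (lcm m n) s ⟩
    gcd m n ^ s * lcm m n ^ s                  ∎)
    where
    instance
      g^s≢0 : NonZero (gcd m n ^ s)
      g^s≢0 = m^n≢0 (gcd m n) s {{gcd≢0ˡ m n}}

  lcm-^-∣ : ∀ {m n x} s → m ^ s ∣ x → n ^ s ∣ x → lcm m n ^ s ∣ x
  lcm-^-∣ {zero}  s 0^s∣x _ = 0^s∣x
  lcm-^-∣ {suc m} {n} s m^s∣x n^s∣x = subst (_∣ _) (lcm-^ (suc m) n s) (lcm-least m^s∣x n^s∣x)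

  ^-cancel-∣ : ∀ {m n} s .{{_ : NonZero s}} → m ^ s ∣ n ^ s → m ∣ n
  ^-cancel-∣ {m} {n} s m^s∣n^s = subst (m ∣_) lcm≡n (m∣lcm[m,n] m n)
    where
    lcm≡n : lcm m n ≡ n
    lcm≡n = ^-injective s (∣-antisym (lcm-^-∣ s m^s∣n^s ∣-refl) (^-monoˡ-∣ s (n∣lcm[m,n] m n)))

  CommonPowDivisor : ℕ → ℕ → ℕ → ℕ → Set
  CommonPowDivisor s a b l = l ^ s ∣ a × l ^ s ∣ b

  common⇒nonZero : ∀ {s a b l} .{{_ : NonZero s}} .{{_ : NonZero b}} → CommonPowDivisor s a b l → NonZero l
  common⇒nonZero {s} (_ , l^s∣b) = ^-nonZero⁻¹ s (∣-nonZero l^s∣b)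

  module _ (s a b : ℕ) where

    bestUpTo : ℕ → ℕ
    bestUpTo zero    = 0
    bestUpTo (suc l) = if ⌊ suc l ^ s ∣? a ⌋ ∧ ⌊ suc l ^ s ∣? b ⌋ then suc l ^ s ⊔ bestUpTo l else bestUpTo l

    bestUpTo-unique : (F : ℕ → ℕ) → F 0 ≡ 0 →
                      (∀ l → F (suc l) ≡ (if ⌊ suc l ^ s ∣? a ⌋ ∧ ⌊ suc l ^ s ∣? b ⌋
                                           then suc l ^ s ⊔ F l else F l)) →
                      ∀ m → F m ≡ bestUpTo m
    bestUpTo-unique F F0 FS zero    = F0
    bestUpTo-unique F F0 FS (suc m) rewrite FS m | bestUpTo-unique F F0 FS m = refl

  -- The auxiliary function of gcdPow is private in Defs; unification still finds it as the F above.
  gcdPow≡bestUpTo : ∀ s a b → gcdPow s a b ≡ bestUpTo s a b (a + b)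
  gcdPow≡bestUpTo s a b with bestUpTo-unique s a b _ refl (λ _ → refl) | a + b
  ... | agreement | m = agreement m

  module _ {s a b : ℕ} where

    bestUpTo-attained : ∀ m → bestUpTo s a b m ≡ 0 ⊎ ∃[ L ] CommonPowDivisor s a b L × bestUpTo s a b m ≡ L ^ s
    bestUpTo-attained zero = inj₁ refl
    bestUpTo-attained (suc k) with suc k ^ s ∣? a | suc k ^ s ∣? b
    ... | no _     | _      = bestUpTo-attained k
    ... | yes _    | no _   = bestUpTo-attained k
    ... | yes ∣a   | yes ∣b  with ⊔-sel (suc k ^ s) (bestUpTo s a b k)
    ...   | inj₁ ⊔≡new  = inj₂ (suc k , (∣a , ∣b) , ⊔≡new)
    ...   | inj₂ ⊔≡best with bestUpTo-attained k
    ...     | inj₁ best≡0            = inj₁ (trans ⊔≡best best≡0)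
    ...     | inj₂ (L , common , eq) = inj₂ (L , common , trans ⊔≡best eq)

    bestUpTo-step : ∀ k → bestUpTo s a b k ≤ bestUpTo s a b (suc k)
    bestUpTo-step k with suc k ^ s ∣? a | suc k ^ s ∣? b
    ... | yes _ | yes _ = m≤n⊔m _ _
    ... | yes _ | no _  = ≤-refl
    ... | no _  | _     = ≤-refl

    bestUpTo-upper : ∀ m {l} → .{{_ : NonZero l}} → l ≤ m → CommonPowDivisor s a b l → l ^ s ≤ bestUpTo s a b m
    bestUpTo-upper zero    {l} l≤0 _ = ⊥-elim (≢-nonZero⁻¹ l (n≤0⇒n≡0 l≤0))
    bestUpTo-upper (suc k) {l} l≤1+k (l∣a , l∣b) with m≤n⇒m<n∨m≡n l≤1+k
    ... | inj₁ l<1+k = ≤-trans (bestUpTo-upper k (≤-pred l<1+k) (l∣a , l∣b)) (bestUpTo-step k)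
    ... | inj₂ refl with suc k ^ s ∣? a | suc k ^ s ∣? b
    ...   | yes _  | yes _  = m≤m⊔n _ _
    ...   | yes _  | no ¬∣b = ⊥-elim (¬∣b l∣b)
    ...   | no ¬∣a | _      = ⊥-elim (¬∣a l∣a)

  record PowGcdRoot (s a b : ℕ) : Set where
    field
      root          : ℕ
      root≢0        : NonZero root
      gcdPow≡root^s : gcdPow s a b ≡ root ^ s
      common        : CommonPowDivisor s a b root
      greatest      : ∀ {l} → CommonPowDivisor s a b l → l ∣ root

    instance
      root-nonZero : NonZero root
      root-nonZero = root≢0

    ∣root⇒common : ∀ {l} → l ∣ root → CommonPowDivisor s a b l
    ∣root⇒common l∣root = ∣-trans l^s∣root^s (proj₁ common) , ∣-trans l^s∣root^s (proj₂ common)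
      where l^s∣root^s = ^-monoˡ-∣ s l∣root

  powGcdRoot : ∀ s a b .{{_ : NonZero s}} .{{_ : NonZero b}} → PowGcdRoot s a b
  powGcdRoot s a b with bestUpTo-attained {s} {a} {b} (a + b)
  ... | inj₁ best≡0 = ⊥-elim (<⇒≱ 0<1^s (subst (1 ^ s ≤_) best≡0 (bestUpTo-upper (a + b) 1≤a+b common-1)))
    where
    0<1^s : 0 < 1 ^ s
    0<1^s = subst (0 <_) (sym (^-zeroˡ s)) z<s
    1≤a+b : 1 ≤ a + b
    1≤a+b = ≤-trans (>-nonZero⁻¹ b) (m≤n+m b a)
    common-1 : CommonPowDivisor s a b 1
    common-1 = subst (_∣ a) (sym (^-zeroˡ s)) (1∣ a) , subst (_∣ b) (sym (^-zeroˡ s)) (1∣ b)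
  ... | inj₂ (L , common-L , best≡L^s) = record
    { root          = L
    ; root≢0        = common⇒nonZero common-L
    ; gcdPow≡root^s = trans (gcdPow≡bestUpTo s a b) best≡L^s
    ; common        = common-L
    ; greatest      = greatest
    }
    where
    maximal : ∀ {l} → CommonPowDivisor s a b l → l ^ s ≤ L ^ s
    maximal {l} common-l = subst (l ^ s ≤_) best≡L^s (bestUpTo-upper (a + b) {{l≢0}} l≤a+b common-l)
      where
      l≢0 = common⇒nonZero common-l
      l≤a+b = ≤-trans (m≤m^n l s) (≤-trans (∣⇒≤ (proj₂ common-l)) (m≤n+m b a))
    greatest : ∀ {l} → CommonPowDivisor s a b l → l ∣ L
    greatest {l} (l∣a , l∣b) = subst (l ∣_) lcm≡L (m∣lcm[m,n] l L)
      where
      common-lcm : CommonPowDivisor s a b (lcm l L)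
      common-lcm = lcm-^-∣ s l∣a (proj₁ common-L) , lcm-^-∣ s l∣b (proj₂ common-L)
      lcm≡L : lcm l L ≡ L
      lcm≡L = ^-injective s (≤-antisym (maximal common-lcm)
                                       (∣⇒≤ {{∣-nonZero (proj₂ common-lcm)}} (^-monoˡ-∣ s (n∣lcm[m,n] l L))))

  gcdPow-*ʳ : ∀ s a b c .{{_ : NonZero s}} .{{_ : NonZero b}} .{{_ : NonZero c}} →
              gcdPow s (a * c ^ s) (b * c ^ s) ≡ gcdPow s a b * c ^ s
  gcdPow-*ʳ s a b c = begin
    gcdPow s (a * c ^ s) (b * c ^ s)  ≡⟨ X.gcdPow≡root^s ⟩
    X.root ^ s                        ≡⟨ cong (_^ s) X≡Y*c ⟩
    (Y.root * c) ^ s                  ≡⟨ ^-distrib-* Y.root c s ⟩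
    Y.root ^ s * c ^ s                ≡⟨ cong (_* c ^ s) (sym Y.gcdPow≡root^s) ⟩
    gcdPow s a b * c ^ s              ∎
    where
    instance
      c^s≢0 : NonZero (c ^ s)
      c^s≢0 = m^n≢0 c s
      b*c^s≢0 : NonZero (b * c ^ s)
      b*c^s≢0 = m*n≢0 b (c ^ s)
    module X = PowGcdRoot (powGcdRoot s (a * c ^ s) (b * c ^ s))
    module Y = PowGcdRoot (powGcdRoot s a b)

    scale : ∀ {l} → CommonPowDivisor s a b l → CommonPowDivisor s (a * c ^ s) (b * c ^ s) (l * c)
    scale (l^s∣a , l^s∣b) = scale-∣ l^s∣a , scale-∣ l^s∣b
      where
      scale-∣ : ∀ {l x} → l ^ s ∣ x → (l * c) ^ s ∣ x * c ^ s
      scale-∣ {l} l^s∣x = subst (_∣ _) (sym (^-distrib-* l c s)) (*-monoˡ-∣ (c ^ s) l^s∣x)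

    unscale : ∀ {l} → CommonPowDivisor s (a * c ^ s) (b * c ^ s) (l * c) → CommonPowDivisor s a b l
    unscale (lc^s∣ac^s , lc^s∣bc^s) = unscale-∣ lc^s∣ac^s , unscale-∣ lc^s∣bc^s
      where
      unscale-∣ : ∀ {l x} → (l * c) ^ s ∣ x * c ^ s → l ^ s ∣ x
      unscale-∣ {l} lc^s∣xc^s = *-cancelʳ-∣ (c ^ s) (subst (_∣ _) (^-distrib-* l c s) lc^s∣xc^s)

    X≡Y*c : X.root ≡ Y.root * c
    X≡Y*c = ∣-antisym X∣Y*c (X.greatest (scale Y.common))
      where
      c∣X : c ∣ X.root
      c∣X = X.greatest (n∣m*n a , n∣m*n b)
      X≡q*c : X.root ≡ quotient c∣X * c
      X≡q*c = m∣n⇒n≡quotient*m c∣X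
      X∣Y*c : X.root ∣ Y.root * c
      X∣Y*c = subst (_∣ Y.root * c) (sym X≡q*c)
                    (*-monoˡ-∣ c (Y.greatest {quotient c∣X} (unscale (subst (CommonPowDivisor s _ _) X≡q*c X.common))))

  ^∣gcdPow⇔common : ∀ s a b .{{_ : NonZero s}} .{{_ : NonZero b}} {l} →
                    l ^ s ∣ gcdPow s a b ⇔ CommonPowDivisor s a b l
  ^∣gcdPow⇔common s a b {l} = mk⇔ (∣root⇒common ∘ ^-cancel-∣ s ∘ subst (l ^ s ∣_) gcdPow≡root^s)
                                  (subst (l ^ s ∣_) (sym gcdPow≡root^s) ∘ ^-monoˡ-∣ s ∘ greatest)
    where open PowGcdRoot (powGcdRoot s a b)

  gcdPow∣ˡ : ∀ s a b .{{_ : NonZero s}} .{{_ : NonZero b}} → gcdPow s a b ∣ a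
  gcdPow∣ˡ s a b = subst (_∣ a) (sym gcdPow≡root^s) (proj₁ common)
    where open PowGcdRoot (powGcdRoot s a b)

  open FiniteSum +-*-commutativeSemiring public using (∑)
  open FiniteSum +-*-commutativeSemiring using (∑-cong; ∑-zero; ∑-comm; ∑-truncate; ∑-δ; ∑-multiples)

  ∑-const-1 : ∀ m → ∑ m (λ _ → 1) ≡ m
  ∑-const-1 zero    = refl
  ∑-const-1 (suc m) = cong suc (∑-const-1 m)

  -- Division made total (n // 0 = 0), so that it can be used under a sum over all d ≤ n.
  _//_ : ℕ → ℕ → ℕ
  n // zero  = 0
  n // suc d = n / suc d

  m*[n//m]≡n : ∀ {m n} .{{_ : NonZero m}} → m ∣ n → m * (n // m) ≡ n
  m*[n//m]≡n {suc m} m∣n = m*[n/m]≡n m∣n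

  //-unique : ∀ m {n k} .{{_ : NonZero m}} → m * k ≡ n → k ≡ n // m
  //-unique (suc m) {k = k} refl = sym (trans (cong (_/ suc m) (*-comm (suc m) k)) (m*n/n≡m k (suc m)))

  //-nonZero : ∀ {m n} .{{_ : NonZero m}} .{{_ : NonZero n}} → m ∣ n → NonZero (n // m)
  //-nonZero {m} {n} m∣n = ≢-nonZero λ n//m≡0 →
    ≢-nonZero⁻¹ n (trans (sym (m*[n//m]≡n m∣n)) (trans (cong (m *_) n//m≡0) (*-zeroʳ m)))

  //-≤ : ∀ m n → n // m ≤ n
  //-≤ zero    n = z≤n
  //-≤ (suc m) n = m/n≤m n (suc m)

  ^-//-split : ∀ {m n} s .{{_ : NonZero m}} → m ∣ n → n ^ s ≡ (n // m) ^ s * m ^ s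
  ^-//-split {m} {n} s m∣n =
    trans (cong (_^ s) (trans (sym (m*[n//m]≡n m∣n)) (*-comm m (n // m)))) (^-distrib-* (n // m) m s)

  ∑-divisor-pairs : ∀ n .{{_ : NonZero n}} (F : ℕ → ℕ → ℕ) →
                    ∑ n (λ d → if ⌊ d ∣? n ⌋ then F d (n // d) else 0)
                    ≡ ∑ n (λ d → ∑ n (λ e → if ⌊ d * e ≟ n ⌋ then F d e else 0))
  ∑-divisor-pairs n F = ∑-cong n pairs-with
    where
    pairs-with : ∀ d → 1 ≤ d → d ≤ n →
                 (if ⌊ d ∣? n ⌋ then F d (n // d) else 0) ≡ ∑ n (λ e → if ⌊ d * e ≟ n ⌋ then F d e else 0)
    pairs-with d 1≤d _ with d ∣? n
    ... | no d∤n = sym (∑-zero n (λ e _ _ → if-no (d * e ≟ n) (λ de≡n → d∤n (divides e (trans (sym de≡n) (*-comm d e))))))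
    ... | yes d∣n = sym (trans (∑-cong n (λ e _ _ → if-cong (d * e ≟ n) (e ≟ n // d) de≡n⇔e≡n//d (cong (F d) ∘ //-unique d)))
                               (∑-δ n (F d (n // d)) (>-nonZero⁻¹ (n // d) {{//-nonZero d∣n}}) (//-≤ d n)))
      where
      instance
        d≢0 : NonZero d
        d≢0 = >-nonZero 1≤d
      de≡n⇔e≡n//d : ∀ {e} → d * e ≡ n ⇔ e ≡ n // d
      de≡n⇔e≡n//d = mk⇔ (//-unique d) (λ { refl → m*[n//m]≡n d∣n })

  ∑-divisors-flip : ∀ n .{{_ : NonZero n}} (F : ℕ → ℕ → ℕ) →
                    ∑ n (λ d → if ⌊ d ∣? n ⌋ then F d (n // d) else 0)
                    ≡ ∑ n (λ d → if ⌊ d ∣? n ⌋ then F (n // d) d else 0)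
  ∑-divisors-flip n F = begin
    ∑ n (λ d → if ⌊ d ∣? n ⌋ then F d (n // d) else 0)
      ≡⟨ ∑-divisor-pairs n F ⟩
    ∑ n (λ d → ∑ n (λ e → if ⌊ d * e ≟ n ⌋ then F d e else 0))
      ≡⟨ ∑-comm n n _ ⟩
    ∑ n (λ e → ∑ n (λ d → if ⌊ d * e ≟ n ⌋ then F d e else 0))
      ≡⟨ ∑-cong n (λ e _ _ → ∑-cong n (λ d _ _ → cong (λ k → if ⌊ k ≟ n ⌋ then F d e else 0) (*-comm d e))) ⟩
    ∑ n (λ e → ∑ n (λ d → if ⌊ e * d ≟ n ⌋ then F d e else 0))
      ≡⟨ sym (∑-divisor-pairs n (flip F)) ⟩
    ∑ n (λ d → if ⌊ d ∣? n ⌋ then F (n // d) d else 0)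
      ∎

  Klee≡∑ : ∀ s m → Klee s m ≡ ∑ m (λ k → if ⌊ gcdPow s k m ≟ 1 ⌋ then 1 else 0)
  Klee≡∑ s m = trans (countUpTo≡∑ m _)
                     (∑-cong m (λ k _ _ → cong (λ b → if b then 1 else 0) (sym (isYes≗does (gcdPow s k m ≟ 1)))))
    where
    countUpTo≡∑ : ∀ m p → countUpTo m p ≡ ∑ m (λ k → if p k then 1 else 0)
    countUpTo≡∑ zero    p = refl
    countUpTo≡∑ (suc m) p = cong ((if p (suc m) then 1 else 0) +_) (countUpTo≡∑ m p)

  ∑-[gcdPow≡c^s]≡Klee : ∀ s m c .{{_ : NonZero s}} .{{_ : NonZero m}} .{{_ : NonZero c}} →
               ∑ (m * c ^ s) (λ k → if ⌊ gcdPow s k (m * c ^ s) ≟ c ^ s ⌋ then 1 else 0) ≡ Klee s m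
  ∑-[gcdPow≡c^s]≡Klee s m c = begin
    ∑ (m * c ^ s) f
      ≡⟨ ∑-cong (m * c ^ s) only-multiples ⟩
    ∑ (m * c ^ s) (λ k → if ⌊ c ^ s ∣? k ⌋ then f k else 0)
      ≡⟨ ∑-multiples m (c ^ s) f ⟩
    ∑ m (λ k → f (k * c ^ s))
      ≡⟨ ∑-cong m (λ k _ _ → if-cong (_ ≟ c ^ s) (gcdPow s k m ≟ 1) (scaled⇔ k) (λ _ → refl)) ⟩
    ∑ m (λ k → if ⌊ gcdPow s k m ≟ 1 ⌋ then 1 else 0)
      ≡⟨ sym (Klee≡∑ s m) ⟩
    Klee s m
      ∎
    where
    instance
      c^s≢0 : NonZero (c ^ s)
      c^s≢0 = m^n≢0 c s
      m*c^s≢0 : NonZero (m * c ^ s)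
      m*c^s≢0 = m*n≢0 m (c ^ s)
    f : ℕ → ℕ
    f k = if ⌊ gcdPow s k (m * c ^ s) ≟ c ^ s ⌋ then 1 else 0
    only-multiples : ∀ k → 1 ≤ k → k ≤ m * c ^ s → f k ≡ (if ⌊ c ^ s ∣? k ⌋ then f k else 0)
    only-multiples k _ _ with c ^ s ∣? k
    ... | yes _     = refl
    ... | no c^s∤k = if-no (_ ≟ c ^ s) (λ g≡c^s → c^s∤k (subst (_∣ k) g≡c^s (gcdPow∣ˡ s k (m * c ^ s))))
    scaled⇔ : ∀ k → gcdPow s (k * c ^ s) (m * c ^ s) ≡ c ^ s ⇔ gcdPow s k m ≡ 1
    scaled⇔ k = mk⇔ (λ eq → *-cancelʳ-≡ _ 1 (c ^ s) (trans (sym scaled) (trans eq (sym (*-identityˡ (c ^ s))))))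
                    (λ eq → trans scaled (trans (cong (_* c ^ s) eq) (*-identityˡ (c ^ s))))
      where scaled = gcdPow-*ʳ s k m c

  ∑-divisors-Klee : ∀ s L .{{_ : NonZero s}} .{{_ : NonZero L}} →
                    ∑ L (λ d → if ⌊ d ∣? L ⌋ then Klee s (d ^ s) else 0) ≡ L ^ s
  ∑-divisors-Klee s L = begin
    ∑ L (λ d → if ⌊ d ∣? L ⌋ then Klee s (d ^ s) else 0)
      ≡⟨ ∑-divisors-flip L (λ d _ → Klee s (d ^ s)) ⟩
    ∑ L (λ c → if ⌊ c ∣? L ⌋ then Klee s ((L // c) ^ s) else 0)
      ≡⟨ ∑-cong L count-level ⟩
    ∑ L (λ c → ∑ (L ^ s) (level c))
      ≡⟨ ∑-comm L (L ^ s) level ⟩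
    ∑ (L ^ s) (λ k → ∑ L (λ c → level c k))
      ≡⟨ ∑-cong (L ^ s) (λ k _ _ → one-level k) ⟩
    ∑ (L ^ s) (λ _ → 1)
      ≡⟨ ∑-const-1 (L ^ s) ⟩
    L ^ s
      ∎
    where
    instance
      L^s≢0 : NonZero (L ^ s)
      L^s≢0 = m^n≢0 L s
    level : ℕ → ℕ → ℕ
    level c k = if ⌊ c ∣? L ⌋ then (if ⌊ gcdPow s k (L ^ s) ≟ c ^ s ⌋ then 1 else 0) else 0

    count-level : ∀ c → 1 ≤ c → c ≤ L →
                  (if ⌊ c ∣? L ⌋ then Klee s ((L // c) ^ s) else 0) ≡ ∑ (L ^ s) (level c)
    count-level c 1≤c _ with c ∣? L
    ... | no _    = sym (∑-zero (L ^ s) (λ _ _ _ → refl))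
    ... | yes c∣L = sym (trans (cong (λ N → ∑ N (λ k → if ⌊ gcdPow s k N ≟ c ^ s ⌋ then 1 else 0)) (^-//-split s c∣L))
                               (∑-[gcdPow≡c^s]≡Klee s ((L // c) ^ s) c))
      where
      instance
        c≢0 : NonZero c
        c≢0 = >-nonZero 1≤c
        L//c^s≢0 : NonZero ((L // c) ^ s)
        L//c^s≢0 = m^n≢0 (L // c) s {{//-nonZero c∣L}}

    one-level : ∀ k → ∑ L (λ c → level c k) ≡ 1
    one-level k = trans (∑-cong L (λ c _ _ → level≡δ c)) (∑-δ L 1 (>-nonZero⁻¹ root) (∣⇒≤ root∣L))
      where
      open PowGcdRoot (powGcdRoot s k (L ^ s))
      root∣L : root ∣ L
      root∣L = ^-cancel-∣ s (proj₂ common)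
      level≡δ : ∀ c → level c k ≡ (if ⌊ c ≟ root ⌋ then 1 else 0)
      level≡δ c with c ∣? L
      ... | yes _   = if-cong (gcdPow s k (L ^ s) ≟ c ^ s) (c ≟ root)
                              (mk⇔ (λ g≡c^s → ^-injective s (trans (sym g≡c^s) gcdPow≡root^s)) (λ { refl → gcdPow≡root^s }))
                              (λ _ → refl)
      ... | no c∤L = sym (if-no (c ≟ root) (λ { refl → c∤L root∣L }))

  gcdPow-as-∑ : ∀ s n b .{{_ : NonZero s}} .{{_ : NonZero n}} →
                gcdPow s b (n ^ s) ≡ ∑ n (λ d → if ⌊ d ∣? n ⌋ then (if ⌊ d ^ s ∣? b ⌋ then Klee s (d ^ s) else 0) else 0)
  gcdPow-as-∑ s n b = begin
    gcdPow s b (n ^ s)  ≡⟨ gcdPow≡root^s ⟩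
    root ^ s            ≡⟨ sym (∑-divisors-Klee s root) ⟩
    ∑ root Φ∣root       ≡⟨ sym (∑-truncate root n Φ∣root (∣⇒≤ root∣n) above-root) ⟩
    ∑ n Φ∣root          ≡⟨ ∑-cong n (λ d _ _ → divides-root d) ⟩
    ∑ n (λ d → if ⌊ d ∣? n ⌋ then (if ⌊ d ^ s ∣? b ⌋ then Klee s (d ^ s) else 0) else 0) ∎
    where
    instance
      n^s≢0 : NonZero (n ^ s)
      n^s≢0 = m^n≢0 n s
    open PowGcdRoot (powGcdRoot s b (n ^ s))
    root∣n : root ∣ n
    root∣n = ^-cancel-∣ s (proj₂ common)
    Φ∣root : ℕ → ℕ
    Φ∣root d = if ⌊ d ∣? root ⌋ then Klee s (d ^ s) else 0
    above-root : ∀ d → root < d → Φ∣root d ≡ 0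
    above-root d root<d = if-no (d ∣? root) (λ d∣root → <⇒≱ root<d (∣⇒≤ d∣root))
    divides-root : ∀ d → Φ∣root d ≡ (if ⌊ d ∣? n ⌋ then (if ⌊ d ^ s ∣? b ⌋ then Klee s (d ^ s) else 0) else 0)
    divides-root d with d ∣? n
    ... | yes d∣n = if-cong (d ∣? root) (d ^ s ∣? b)
                            (mk⇔ (proj₁ ∘ ∣root⇒common) (λ d^s∣b → greatest (d^s∣b , ^-monoˡ-∣ s d∣n))) (λ _ → refl)
    ... | no d∤n  = if-no (d ∣? root) (λ d∣root → d∤n (∣-trans d∣root root∣n))

  n^s/m^s≡[n//m]^s : ∀ {m n} s .{{_ : NonZero m}} → m ∣ n → (n ^ s / m ^ s) {{m^n≢0 m s}} ≡ (n // m) ^ s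
  n^s/m^s≡[n//m]^s {m} {n} s m∣n =
    trans (cong (λ x → (x / m ^ s) {{m^n≢0 m s}}) (^-//-split s m∣n)) (m*n/n≡m _ (m ^ s) {{m^n≢0 m s}})

  kleeTerm : ℕ → ℕ → ℕ → ℕ → ℕ
  kleeTerm s N g zero    = 0
  kleeTerm s N g (suc d) = if ⌊ suc d ^ s ∣? g ⌋ then suc d ^ s * Klee s ((N / suc d ^ s) {{m^n≢0 (suc d) s}}) else 0

  kleeSum≡∑ : ∀ s N g d → kleeSum s N g d ≡ ∑ d (kleeTerm s N g)
  kleeSum≡∑ s N g zero    = refl
  kleeSum≡∑ s N g (suc d) = cong (kleeTerm s N g (suc d) +_) (kleeSum≡∑ s N g d)

  kleeSum-as-∑ : ∀ s n j .{{_ : NonZero s}} .{{_ : NonZero n}} →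
                 kleeSum s (n ^ s) (gcdPow s j (n ^ s)) (gcdPow s j (n ^ s))
                 ≡ ∑ n (λ e → if ⌊ e ∣? n ⌋ then Klee s ((n // e) ^ s) * (if ⌊ e ^ s ∣? j ⌋ then e ^ s else 0) else 0)
  kleeSum-as-∑ s n j = begin
    kleeSum s (n ^ s) g g             ≡⟨ kleeSum≡∑ s (n ^ s) g g ⟩
    ∑ g (kleeTerm s (n ^ s) g)        ≡⟨ sym (∑-truncate g (g + n) _ (m≤m+n g n) above-g) ⟩
    ∑ (g + n) (kleeTerm s (n ^ s) g)  ≡⟨ ∑-cong (g + n) (λ e 1≤e _ → kleeTerm≡ e 1≤e) ⟩
    ∑ (g + n) term                    ≡⟨ ∑-truncate n (g + n) term (m≤n+m n g) above-n ⟩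
    ∑ n term                          ∎
    where
    instance
      n^s≢0 : NonZero (n ^ s)
      n^s≢0 = m^n≢0 n s
    g = gcdPow s j (n ^ s)
    open PowGcdRoot (powGcdRoot s j (n ^ s))
    instance
      g≢0 : NonZero g
      g≢0 = subst NonZero (sym gcdPow≡root^s) (m^n≢0 root s)
    term : ℕ → ℕ
    term e = if ⌊ e ∣? n ⌋ then Klee s ((n // e) ^ s) * (if ⌊ e ^ s ∣? j ⌋ then e ^ s else 0) else 0

    above-g : ∀ e → g < e → kleeTerm s (n ^ s) g e ≡ 0
    above-g (suc e) g<e = if-no (suc e ^ s ∣? g) (λ e^s∣g → <⇒≱ g<e (≤-trans (m≤m^n (suc e) s) (∣⇒≤ e^s∣g)))

    above-n : ∀ e → n < e → term e ≡ 0
    above-n e n<e = if-no (e ∣? n) (λ e∣n → <⇒≱ n<e (∣⇒≤ e∣n))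

    e^s∣g⇔common : ∀ {e} → e ^ s ∣ g ⇔ CommonPowDivisor s j (n ^ s) e
    e^s∣g⇔common = ^∣gcdPow⇔common s j (n ^ s)

    kleeTerm≡ : ∀ e → 1 ≤ e → kleeTerm s (n ^ s) g e ≡ term e
    kleeTerm≡ (suc e) _ with suc e ∣? n
    ... | no e∤n  = if-no (suc e ^ s ∣? g) (λ e^s∣g → e∤n (^-cancel-∣ s (proj₂ (Equivalence.to e^s∣g⇔common e^s∣g))))
    ... | yes e∣n = begin
      (if ⌊ suc e ^ s ∣? g ⌋ then suc e ^ s * Klee s ((n ^ s / suc e ^ s) {{m^n≢0 (suc e) s}}) else 0)
        ≡⟨ if-cong (suc e ^ s ∣? g) (suc e ^ s ∣? j) e^s∣g⇔e^s∣j (λ _ → value) ⟩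
      (if ⌊ suc e ^ s ∣? j ⌋ then Φ * suc e ^ s else 0)
        ≡⟨ cong (if ⌊ suc e ^ s ∣? j ⌋ then Φ * suc e ^ s else_) (sym (*-zeroʳ Φ)) ⟩
      (if ⌊ suc e ^ s ∣? j ⌋ then Φ * suc e ^ s else Φ * 0)
        ≡⟨ sym (if-float (Φ *_) ⌊ suc e ^ s ∣? j ⌋) ⟩
      Φ * (if ⌊ suc e ^ s ∣? j ⌋ then suc e ^ s else 0)
        ∎
      where
      Φ = Klee s ((n // suc e) ^ s)
      e^s∣g⇔e^s∣j : suc e ^ s ∣ g ⇔ suc e ^ s ∣ j
      e^s∣g⇔e^s∣j = mk⇔ (proj₁ ∘ Equivalence.to e^s∣g⇔common)
                        (λ e^s∣j → Equivalence.from e^s∣g⇔common (e^s∣j , ^-monoˡ-∣ s e∣n))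
      value : suc e ^ s * Klee s ((n ^ s / suc e ^ s) {{m^n≢0 (suc e) s}}) ≡ Φ * suc e ^ s
      value = trans (cong (λ x → suc e ^ s * Klee s x) (n^s/m^s≡[n//m]^s s e∣n)) (*-comm (suc e ^ s) Φ)

module CharacterSums {c ℓ} (R : CommutativeRing c ℓ) where

  open import Data.Nat as ℕ using (ℕ; zero; suc; NonZero; _^_; z<s; >-nonZero; >-nonZero⁻¹)
  import Data.Nat.Properties as ℕₚ
  open import Data.Nat.Divisibility using (_∣_; _∣?_; divides; m%n≡0⇒n∣m)
  open import Data.Nat.DivMod using (_%_; _/_; m≡m%n+[m/n]*n; m%n<n)
  open import Data.Nat.Solver using (module +-*-Solver)
  open +-*-Solver using (solve; _:=_; _:*_)
  open import Data.Sum using (fromInj₂)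
  open CommutativeRing R
  open import Relation.Binary.Reasoning.Setoid setoid
  open import Algebra.Properties.Group +-group using (∙-cancelʳ; x∙y⁻¹≈ε⇒x≈y; x≈y⇒x∙y⁻¹≈ε)
  open import Algebra.Properties.Ring ring using (-1*x≈-x)
  open FiniteSum commutativeSemiring
  open Arithmetic using (_//_; //-nonZero; ^-//-split; ∑-divisors-flip; gcdPow-as-∑; kleeSum-as-∑)

  sumR≈∑ : ∀ m f → sumR R m f ≈ ∑ m f
  sumR≈∑ zero    f = refl
  sumR≈∑ (suc m) f = +-congˡ (sumR≈∑ m f)

  fromℕ-+ : ∀ m n → fromℕ R (m ℕ.+ n) ≈ fromℕ R m + fromℕ R n
  fromℕ-+ zero    n = sym (+-identityˡ _)
  fromℕ-+ (suc m) n = trans (+-congˡ (fromℕ-+ m n)) (sym (+-assoc _ _ _))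

  fromℕ-* : ∀ m n → fromℕ R (m ℕ.* n) ≈ fromℕ R m * fromℕ R n
  fromℕ-* zero    n = sym (zeroˡ _)
  fromℕ-* (suc m) n = begin
    fromℕ R (n ℕ.+ m ℕ.* n)                   ≈⟨ fromℕ-+ n (m ℕ.* n) ⟩
    fromℕ R n + fromℕ R (m ℕ.* n)             ≈⟨ +-cong (sym (*-identityˡ _)) (fromℕ-* m n) ⟩
    1# * fromℕ R n + fromℕ R m * fromℕ R n    ≈⟨ sym (distribʳ _ _ _) ⟩
    (1# + fromℕ R m) * fromℕ R n              ∎

  fromℕ-∑ : ∀ m f → fromℕ R (Arithmetic.∑ m f) ≈ ∑ m (fromℕ R ∘ f)
  fromℕ-∑ zero    f = refl
  fromℕ-∑ (suc m) f = trans (fromℕ-+ (f (suc m)) _) (+-congˡ (fromℕ-∑ m f))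

  ∑-const-1# : ∀ m → ∑ m (λ _ → 1#) ≈ fromℕ R m
  ∑-const-1# zero    = refl
  ∑-const-1# (suc m) = +-congˡ (∑-const-1# m)

  pow-congˡ : ∀ {x y} n → x ≈ y → pow R x n ≈ pow R y n
  pow-congˡ zero    x≈y = refl
  pow-congˡ (suc n) x≈y = *-cong x≈y (pow-congˡ n x≈y)

  pow-+ : ∀ x m n → pow R x (m ℕ.+ n) ≈ pow R x m * pow R x n
  pow-+ x zero    n = sym (*-identityˡ _)
  pow-+ x (suc m) n = trans (*-congˡ (pow-+ x m n)) (sym (*-assoc _ _ _))

  pow-* : ∀ x m n → pow R x (m ℕ.* n) ≈ pow R (pow R x m) n
  pow-* x m zero    = reflexive (≡.cong (pow R x) (ℕₚ.*-zeroʳ m))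
  pow-* x m (suc n) = begin
    pow R x (m ℕ.* suc n)              ≡⟨ ≡.cong (pow R x) (ℕₚ.*-suc m n) ⟩
    pow R x (m ℕ.+ m ℕ.* n)            ≈⟨ pow-+ x m (m ℕ.* n) ⟩
    pow R x m * pow R x (m ℕ.* n)      ≈⟨ *-congˡ (pow-* x m n) ⟩
    pow R x m * pow R (pow R x m) n    ∎

  pow-1# : ∀ n → pow R 1# n ≈ 1#
  pow-1# zero    = refl
  pow-1# (suc n) = trans (*-identityˡ _) (pow-1# n)

  pow-root-of-unity : ∀ {ω} M → pow R ω M ≈ 1# → ∀ k → pow R ω (M ℕ.* k) ≈ 1#
  pow-root-of-unity {ω} M ω^M≈1 k = trans (pow-* ω M k) (trans (pow-congˡ k ω^M≈1) (pow-1# k))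

  primitive⇒∣ : ∀ {M ω} .{{_ : NonZero M}} → IsPrimitiveRoot R M ω → ∀ t → pow R ω t ≈ 1# → M ∣ t
  primitive⇒∣ {M} {ω} (ω^M≈1 , minimal) t ω^t≈1 with t % M in t%M≡r
  ... | zero  = m%n≡0⇒n∣m t M t%M≡r
  ... | suc r = ⊥-elim (minimal (suc r) z<s (≡.subst (ℕ._< M) t%M≡r (m%n<n t M)) ω^r≈1)
    where
    ω^r≈1 : pow R ω (suc r) ≈ 1#
    ω^r≈1 = begin
      pow R ω (suc r)                            ≈⟨ sym (*-identityʳ _) ⟩
      pow R ω (suc r) * 1#                       ≈⟨ *-congˡ (sym (pow-root-of-unity M ω^M≈1 (t / M))) ⟩
      pow R ω (suc r) * pow R ω (M ℕ.* (t / M))  ≈⟨ sym (pow-+ ω (suc r) _) ⟩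
      pow R ω (suc r ℕ.+ M ℕ.* (t / M))          ≡⟨ ≡.cong (pow R ω) t≡r+M[t/M] ⟩
      pow R ω t                                  ≈⟨ ω^t≈1 ⟩
      1#                                         ∎
      where
      t≡r+M[t/M] : suc r ℕ.+ M ℕ.* (t / M) ≡ t
      t≡r+M[t/M] = ≡.trans (≡.cong₂ ℕ._+_ (≡.sym t%M≡r) (ℕₚ.*-comm M (t / M))) (≡.sym (m≡m%n+[m/n]*n t M))

  primitive-pow : ∀ {M K ω} .{{_ : NonZero K}} → IsPrimitiveRoot R (M ℕ.* K) ω → IsPrimitiveRoot R M (pow R ω K)
  primitive-pow {M} {K} {ω} (ω^MK≈1 , minimal) = ω^K^M≈1 , ω^K-minimal
    where
    ω^K^M≈1 : pow R (pow R ω K) M ≈ 1#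
    ω^K^M≈1 = trans (sym (pow-* ω K M)) (trans (reflexive (≡.cong (pow R ω) (ℕₚ.*-comm K M))) ω^MK≈1)
    ω^K-minimal : ∀ k → 0 ℕ.< k → k ℕ.< M → ¬ (pow R (pow R ω K) k ≈ 1#)
    ω^K-minimal k 0<k k<M ω^Kk≈1 = minimal (K ℕ.* k) 0<Kk Kk<MK (trans (pow-* ω K k) ω^Kk≈1)
      where
      instance
        k≢0 : NonZero k
        k≢0 = >-nonZero 0<k
      0<Kk : 0 ℕ.< K ℕ.* k
      0<Kk = >-nonZero⁻¹ (K ℕ.* k) {{ℕₚ.m*n≢0 K k}}
      Kk<MK : K ℕ.* k ℕ.< M ℕ.* K
      Kk<MK = ≡.subst (K ℕ.* k ℕ.<_) (ℕₚ.*-comm K M) (ℕₚ.*-monoʳ-< K k<M)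

  ∑-pow-shift : ∀ θ m → θ * ∑ m (pow R θ) + θ ≈ ∑ m (pow R θ) + pow R θ (suc m)
  ∑-pow-shift θ zero    = trans (+-congʳ (zeroʳ θ)) (+-congˡ (sym (*-identityʳ θ)))
  ∑-pow-shift θ (suc m) = begin
    θ * (pow R θ (suc m) + S) + θ                ≈⟨ +-congʳ (distribˡ θ _ _) ⟩
    (pow R θ (suc (suc m)) + θ * S) + θ          ≈⟨ +-assoc _ _ _ ⟩
    pow R θ (suc (suc m)) + (θ * S + θ)          ≈⟨ +-congˡ (∑-pow-shift θ m) ⟩
    pow R θ (suc (suc m)) + (S + pow R θ (suc m)) ≈⟨ +-comm _ _ ⟩
    (S + pow R θ (suc m)) + pow R θ (suc (suc m)) ≈⟨ +-congʳ (+-comm _ _) ⟩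
    (pow R θ (suc m) + S) + pow R θ (suc (suc m)) ∎
    where S = ∑ m (pow R θ)

  ∑-pow≈0 : IsIntegralDomain R → ∀ {θ} M → pow R θ M ≈ 1# → ¬ (θ ≈ 1#) → ∑ M (pow R θ) ≈ 0#
  ∑-pow≈0 domain {θ} M θ^M≈1 θ≉1 = fromInj₂ (⊥-elim ∘ θ≉1 ∘ x∙y⁻¹≈ε⇒x≈y θ 1#) (domain (θ - 1#) S θ-1*S≈0)
    where
    S = ∑ M (pow R θ)
    θS≈S : θ * S ≈ S
    θS≈S = ∙-cancelʳ θ (θ * S) S (trans (∑-pow-shift θ M) (+-congˡ (trans (*-congˡ θ^M≈1) (*-identityʳ θ))))
    θ-1*S≈0 : (θ - 1#) * S ≈ 0#
    θ-1*S≈0 = begin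
      (θ - 1#) * S          ≈⟨ distribʳ S θ (- 1#) ⟩
      θ * S + (- 1#) * S    ≈⟨ +-congˡ (-1*x≈-x S) ⟩
      θ * S - S             ≈⟨ x≈y⇒x∙y⁻¹≈ε θS≈S ⟩
      0#                    ∎

  ∑-primitive-root : IsIntegralDomain R → ∀ {M ω} .{{_ : NonZero M}} → IsPrimitiveRoot R M ω → ∀ j →
                     ∑ M (λ b → pow R ω (b ℕ.* j)) ≈ fromℕ R (if ⌊ M ∣? j ⌋ then M else 0)
  ∑-primitive-root domain {M} {ω} ω-primitive@(ω^M≈1 , _) j with M ∣? j
  ... | yes (divides q ≡.refl) = trans (∑-cong M (λ b _ _ → ω^bj≈1 b)) (∑-const-1# M)
    where
    ω^bj≈1 : ∀ b → pow R ω (b ℕ.* (q ℕ.* M)) ≈ 1#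
    ω^bj≈1 b = trans (reflexive (≡.cong (pow R ω) (solve 3 (λ b q M → b :* (q :* M) := M :* (b :* q)) ≡.refl b q M)))
                     (pow-root-of-unity M ω^M≈1 (b ℕ.* q))
  ... | no M∤j = trans (∑-cong M (λ b _ _ → ω^bj≈θ^b b)) (∑-pow≈0 domain M θ^M≈1 θ≉1)
    where
    θ = pow R ω j
    ω^bj≈θ^b : ∀ b → pow R ω (b ℕ.* j) ≈ pow R θ b
    ω^bj≈θ^b b = trans (reflexive (≡.cong (pow R ω) (ℕₚ.*-comm b j))) (pow-* ω j b)
    θ^M≈1 : pow R θ M ≈ 1#
    θ^M≈1 = trans (sym (pow-* ω j M))
                  (trans (reflexive (≡.cong (pow R ω) (ℕₚ.*-comm j M))) (pow-root-of-unity M ω^M≈1 j))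
    θ≉1 : ¬ (θ ≈ 1#)
    θ≉1 = M∤j ∘ primitive⇒∣ ω-primitive j

  ∑-multiples-primitive-root : IsIntegralDomain R → ∀ M K {ω} .{{_ : NonZero M}} .{{_ : NonZero K}} →
                               IsPrimitiveRoot R (M ℕ.* K) ω → ∀ j →
                               ∑ (M ℕ.* K) (λ b → if ⌊ K ∣? b ⌋ then pow R ω (b ℕ.* j) else 0#)
                               ≈ fromℕ R (if ⌊ M ∣? j ⌋ then M else 0)
  ∑-multiples-primitive-root domain M K {ω} ω-primitive j = begin
    ∑ (M ℕ.* K) (λ b → if ⌊ K ∣? b ⌋ then pow R ω (b ℕ.* j) else 0#)  ≈⟨ ∑-multiples M K (λ b → pow R ω (b ℕ.* j)) ⟩
    ∑ M (λ b → pow R ω (b ℕ.* K ℕ.* j))                                ≈⟨ ∑-cong M (λ b _ _ → ω^bKj≈[ω^K]^bj b) ⟩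
    ∑ M (λ b → pow R (pow R ω K) (b ℕ.* j))                            ≈⟨ ∑-primitive-root domain (primitive-pow ω-primitive) j ⟩
    fromℕ R (if ⌊ M ∣? j ⌋ then M else 0)                              ∎
    where
    ω^bKj≈[ω^K]^bj : ∀ b → pow R ω (b ℕ.* K ℕ.* j) ≈ pow R (pow R ω K) (b ℕ.* j)
    ω^bKj≈[ω^K]^bj b = trans (reflexive (≡.cong (pow R ω) (solve 3 (λ b K j → b :* K :* j := K :* (b :* j)) ≡.refl b K j)))
                             (pow-* ω K (b ℕ.* j))

  ∑-divisor-block : IsIntegralDomain R → ∀ n s {d ζ} .{{_ : NonZero n}} .{{_ : NonZero d}} →
                    IsPrimitiveRoot R (n ^ s) ζ → d ∣ n → ∀ j K →
                    ∑ (n ^ s) (λ b → fromℕ R (if ⌊ d ^ s ∣? b ⌋ then K else 0) * pow R ζ (b ℕ.* j))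
                    ≈ fromℕ R (K ℕ.* (if ⌊ (n // d) ^ s ∣? j ⌋ then (n // d) ^ s else 0))
  ∑-divisor-block domain n s {d} {ζ} ζ-primitive d∣n j K = begin
    ∑ (n ^ s) (λ b → fromℕ R (if ⌊ d ^ s ∣? b ⌋ then K else 0) * w b)
      ≈⟨ ∑-cong (n ^ s) (λ b _ _ → pull-out b) ⟩
    ∑ (n ^ s) (λ b → fromℕ R K * w∣ b)
      ≈⟨ sym (*-distribˡ-∑ (n ^ s) (fromℕ R K) w∣) ⟩
    fromℕ R K * ∑ (n ^ s) w∣
      ≡⟨ ≡.cong (λ N → fromℕ R K * ∑ N w∣) n^s≡e^s*d^s ⟩
    fromℕ R K * ∑ (e ^ s ℕ.* d ^ s) w∣
      ≈⟨ *-congˡ (∑-multiples-primitive-root domain (e ^ s) (d ^ s) ζ-primitive′ j) ⟩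
    fromℕ R K * fromℕ R (if ⌊ e ^ s ∣? j ⌋ then e ^ s else 0)
      ≈⟨ sym (fromℕ-* K _) ⟩
    fromℕ R (K ℕ.* (if ⌊ e ^ s ∣? j ⌋ then e ^ s else 0))
      ∎
    where
    e = n // d
    instance
      e^s≢0 : NonZero (e ^ s)
      e^s≢0 = ℕₚ.m^n≢0 e s {{//-nonZero d∣n}}
      d^s≢0 : NonZero (d ^ s)
      d^s≢0 = ℕₚ.m^n≢0 d s
    n^s≡e^s*d^s : n ^ s ≡ e ^ s ℕ.* d ^ s
    n^s≡e^s*d^s = ^-//-split s d∣n
    ζ-primitive′ : IsPrimitiveRoot R (e ^ s ℕ.* d ^ s) ζ
    ζ-primitive′ = ≡.subst (λ N → IsPrimitiveRoot R N ζ) n^s≡e^s*d^s ζ-primitive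
    w : ℕ → Carrier
    w b = pow R ζ (b ℕ.* j)
    w∣ : ℕ → Carrier
    w∣ b = if ⌊ d ^ s ∣? b ⌋ then w b else 0#
    pull-out : ∀ b → fromℕ R (if ⌊ d ^ s ∣? b ⌋ then K else 0) * w b ≈ fromℕ R K * w∣ b
    pull-out b with d ^ s ∣? b
    ... | yes _ = refl
    ... | no _  = trans (zeroˡ (w b)) (sym (zeroʳ (fromℕ R K)))

  gcdPow-character-sum : IsIntegralDomain R → ∀ n s j .{{_ : NonZero n}} .{{_ : NonZero s}} ζ →
                         IsPrimitiveRoot R (n ^ s) ζ →
                         sumR R (n ^ s) (λ b → fromℕ R (gcdPow s b (n ^ s)) * pow R ζ (b ℕ.* j))
                         ≈ fromℕ R (kleeSum s (n ^ s) (gcdPow s j (n ^ s)) (gcdPow s j (n ^ s)))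
  gcdPow-character-sum domain n s j ζ ζ-primitive = begin
    sumR R N (λ b → fromℕ R (gcdPow s b N) * w b)
      ≈⟨ sumR≈∑ N _ ⟩
    ∑ N (λ b → fromℕ R (gcdPow s b N) * w b)
      ≈⟨ ∑-cong N (λ b _ _ → *-congʳ (reflexive (≡.cong (fromℕ R) (gcdPow-as-∑ s n b)))) ⟩
    ∑ N (λ b → fromℕ R (Arithmetic.∑ n (λ d → A d b)) * w b)
      ≈⟨ ∑-cong N (λ b _ _ → trans (*-congʳ (fromℕ-∑ n _)) (*-distribʳ-∑ n (w b) _)) ⟩
    ∑ N (λ b → ∑ n (λ d → fromℕ R (A d b) * w b))
      ≈⟨ ∑-comm N n _ ⟩
    ∑ n (λ d → ∑ N (λ b → fromℕ R (A d b) * w b))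
      ≈⟨ ∑-cong n (λ d 1≤d _ → per-divisor d 1≤d) ⟩
    ∑ n (λ d → fromℕ R (H d))
      ≈⟨ sym (fromℕ-∑ n H) ⟩
    fromℕ R (Arithmetic.∑ n H)
      ≡⟨ ≡.cong (fromℕ R) (≡.trans (∑-divisors-flip n F) (≡.sym (kleeSum-as-∑ s n j))) ⟩
    fromℕ R (kleeSum s N (gcdPow s j N) (gcdPow s j N))
      ∎
    where
    N = n ^ s
    w : ℕ → Carrier
    w b = pow R ζ (b ℕ.* j)
    A : ℕ → ℕ → ℕ
    A d b = if ⌊ d ∣? n ⌋ then (if ⌊ d ^ s ∣? b ⌋ then Klee s (d ^ s) else 0) else 0
    F : ℕ → ℕ → ℕ
    F d e = Klee s (d ^ s) ℕ.* (if ⌊ e ^ s ∣? j ⌋ then e ^ s else 0)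
    H : ℕ → ℕ
    H d = if ⌊ d ∣? n ⌋ then F d (n // d) else 0
    per-divisor : ∀ d → 1 ℕ.≤ d → ∑ N (λ b → fromℕ R (A d b) * w b) ≈ fromℕ R (H d)
    per-divisor d 1≤d with d ∣? n
    ... | yes d∣n = ∑-divisor-block domain n s ζ-primitive d∣n j (Klee s (d ^ s))
      where
      instance
        d≢0 : NonZero d
        d≢0 = >-nonZero 1≤d
    ... | no _    = ∑-zero N (λ b _ _ → zeroˡ (w b))

open import Data.Nat using (ℕ; _^_; _*_; NonZero)

lemma3p3 : {c ℓ : Level} (R : CommutativeRing c ℓ) →
    IsIntegralDomain R → CharZero R →
    (n s j : ℕ) → .{{_ : NonZero n}} → .{{_ : NonZero s}} → .{{_ : NonZero j}} →
    (ζ : CommutativeRing.Carrier R) → IsPrimitiveRoot R (n ^ s) ζ →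
    CommutativeRing._≈_ R
    (sumR R (n ^ s) (λ b → CommutativeRing._*_ R (fromℕ R (gcdPow s b (n ^ s))) (pow R ζ (b * j))))
    (fromℕ R (kleeSum s (n ^ s) (gcdPow s j (n ^ s)) (gcdPow s j (n ^ s))))
lemma3p3 R domain _ n s j = CharacterSums.gcdPow-character-sum R domain n s j
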